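{- Let $\pi$ be a projective plane of order $q$, let $2\leq n\leq q$, and let $\phi$ be an embedding of $K_{n,q}$ into $\pi$, where $U$ and $V$ are the two classes of $K_{n,q}$ with $|U|=n$ and $|V|=q$. Then all points of $\phi(U)$ are collinear.
   Context: Graphs are finite, simple and undirected. An embedding of a graph $G=(V,E)$ into a projective plane $\pi=(\mathcal P,\mathcal L,\mathcal I)$ is an injective map $\phi:V\to\mathcal P$ such that the induced map $E\to\mathcal L$, sending an edge $ab$ to the unique line through $\phi(a)$ and $\phi(b)$, is injective. -}

module Defs where

open import Data.Nat using (ℕ; suc)
open import Data.Fin using (Fin)
open import Data.Bool using (Bool; true)
open import Data.Sum using (_⊎_; inj₁; inj₂)
open import Data.Product using (Σ; ∃; _×_; _,_)
open import Data.Empty using (⊥)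
open import Relation.Nullary using (¬_)
open import Relation.Binary.PropositionalEquality using (_≡_; _≢_; refl)
open import Function.Bundles using (_↔_)

record ProjectivePlane : Set₁ where
  field
    Point : Set
    Line  : Set
    inc   : Point → Line → Bool

  _I_ : Point → Line → Set
  p I l = inc p l ≡ true

  field
    join      : (p r : Point) → p ≢ r → Line
    join-incˡ : (p r : Point) (h : p ≢ r) → p I join p r h
    join-incʳ : (p r : Point) (h : p ≢ r) → r I join p r h
    join-uniq : (p r : Point) (h : p ≢ r) (l : Line) → p I l → r I l → l ≡ join p r h
    meet      : (l m : Line) → l ≢ m → Point
    meet-incˡ : (l m : Line) (h : l ≢ m) → meet l m h I l
    meet-incʳ : (l m : Line) (h : l ≢ m) → meet l m h I m
    meet-uniq : (l m : Line) (h : l ≢ m) (p : Point) → p I l → p I m → p ≡ meet l m h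
    quad      : Fin 4 → Point
    quad-inj  : (i j : Fin 4) → quad i ≡ quad j → i ≡ j
    quad-gen  : (i j k : Fin 4) → i ≢ j → j ≢ k → i ≢ k →
                (l : Line) → quad i I l → quad j I l → ¬ (quad k I l)

  Collinear : {A : Set} → (A → Point) → Set
  Collinear f = Σ Line λ l → ∀ a → f a I l

HasOrder : ProjectivePlane → ℕ → Set
HasOrder π q = (l : Line) → (Σ Point λ p → p I l) ↔ Fin (suc q)
  where open ProjectivePlane π

record Graph : Set₁ where
  field
    Vertex  : Set
    Adj     : Vertex → Vertex → Set
    Adj-sym : ∀ {a b} → Adj a b → Adj b a
    Adj-irr : ∀ {a} → ¬ Adj a a

edgeLine : (G : Graph) (π : ProjectivePlane) →
           (φ : Graph.Vertex G → ProjectivePlane.Point π) →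
           (∀ a b → φ a ≡ φ b → a ≡ b) →
           ∀ a b → Graph.Adj G a b → ProjectivePlane.Line π
edgeLine G π φ φ-inj a b e = join (φ a) (φ b) ne
  where
    open Graph G
    open ProjectivePlane π
    ne : φ a ≢ φ b
    ne eq with φ-inj a b eq
    ... | refl = Adj-irr e

record Embedding (G : Graph) (π : ProjectivePlane) : Set where
  open Graph G
  open ProjectivePlane π
  field
    φ        : Vertex → Point
    φ-inj    : ∀ a b → φ a ≡ φ b → a ≡ b
    line-inj : ∀ a b a' b' (e : Adj a b) (e' : Adj a' b') →
               edgeLine G π φ φ-inj a b e ≡ edgeLine G π φ φ-inj a' b' e' →
               (a ≡ a' × b ≡ b') ⊎ (a ≡ b' × b ≡ a')

-- Complete bipartite graph K_{n,m} with classes U = Fin n (inj₁) and V = Fin m (inj₂).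
data BipAdj (n m : ℕ) : Fin n ⊎ Fin m → Fin n ⊎ Fin m → Set where
  uv : (u : Fin n) (v : Fin m) → BipAdj n m (inj₁ u) (inj₂ v)
  vu : (v : Fin m) (u : Fin n) → BipAdj n m (inj₂ v) (inj₁ u)

K : ℕ → ℕ → Graph
K n m = record
  { Vertex  = Fin n ⊎ Fin m
  ; Adj     = BipAdj n m
  ; Adj-sym = λ { (uv u v) → vu v u ; (vu v u) → uv u v }
  ; Adj-irr = λ () }

-- If three points φ(a), φ(b), φ(c) of φ(U) were not collinear, take the line M
-- joining φ(b) to some φ(v), v ∈ V.  Through φ(a), which is off M, pass the q + 2
-- distinct lines φ(a)φ(b), φ(a)φ(c) and φ(a)φ(v) for v ∈ V; they cut M in
-- q + 2 distinct points, but M has only q + 1.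
module Submission where

open import Defs
open import Data.Nat using (ℕ; suc; _≤_; s≤s)
open import Data.Nat.Properties using (1+n≰n)
open import Data.Fin using (Fin; zero; suc)
open import Data.Fin.Properties using (injective⇒≤)
open import Data.Vec.Functional using (_∷_)
open import Data.Bool using (true)
open import Data.Bool.Properties using (_≟_)
open import Data.Sum using (inj₁; inj₂)
open import Data.Sum.Properties using (inj₁-injective; inj₂-injective)
open import Data.Product using (_,_; proj₁; proj₂; _×_)
open import Data.Empty using (⊥-elim)
open import Relation.Nullary using (¬_)
open import Relation.Nullary.Decidable using (decidable-stable)
open import Relation.Binary.PropositionalEquality
open import Function using (_∘_)
open import Function.Bundles using (Injection; Inverse)
open import Function.Definitions using (Injective)
open import Function.Properties.Inverse using (↔⇒↣)

∷-injective : ∀ {A : Set} {n} {x : A} {f : Fin n → A} →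
              (∀ i → x ≢ f i) → Injective _≡_ _≡_ f → Injective _≡_ _≡_ (x ∷ f)
∷-injective x∉f f-inj {zero}  {zero}  _  = refl
∷-injective x∉f f-inj {zero}  {suc j} eq = ⊥-elim (x∉f j eq)
∷-injective x∉f f-inj {suc i} {zero}  eq = ⊥-elim (x∉f i (sym eq))
∷-injective x∉f f-inj {suc i} {suc j} eq = cong suc (f-inj eq)

module PlaneProperties (π : ProjectivePlane) where
  open ProjectivePlane π

  I-stable : ∀ {p l} → ¬ ¬ (p I l) → p I l
  I-stable = decidable-stable (_ ≟ true)

  I-respects-≢ : ∀ {p l m} → p I l → ¬ (p I m) → l ≢ m
  I-respects-≢ p∈l p∉m refl = p∉m p∈l

  line-unique : ∀ {p r l m} → p ≢ r → p I l → r I l → p I m → r I m → l ≡ m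
  line-unique p≢r p∈l r∈l p∈m r∈m =
    trans (join-uniq _ _ p≢r _ p∈l r∈l) (sym (join-uniq _ _ p≢r _ p∈m r∈m))

  meet-injective : ∀ {A : Set} {p M} (p∉M : ¬ (p I M)) (f : A → Line) (p∈f : ∀ a → p I f a) →
                   Injective _≡_ _≡_ f →
                   Injective _≡_ _≡_ (λ a → meet (f a) M (I-respects-≢ (p∈f a) p∉M))
  meet-injective {p = p} {M} p∉M f p∈f f-inj {a} {b} eq = f-inj
    (line-unique p≢x (p∈f a) (meet-incˡ _ _ _) (p∈f b) (subst (_I f b) (sym eq) (meet-incˡ _ _ _)))
    where
    p≢x : p ≢ meet (f a) M _
    p≢x p≡x = p∉M (subst (_I M) (sym p≡x) (meet-incʳ _ _ _))

  module _ {q : ℕ} (order : HasOrder π q) where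

    points-on-line-bound : ∀ {k} {M} (g : Fin k → Point) → (∀ i → g i I M) →
                           Injective _≡_ _≡_ g → k ≤ suc q
    points-on-line-bound {M = M} g g∈M g-inj =
      injective⇒≤ {f = position} (λ eq → g-inj (cong proj₁ (Injection.injective (↔⇒↣ (order M)) eq)))
      where
      position : Fin _ → Fin (suc q)
      position i = Inverse.to (order M) (g i , g∈M i)

    pencil-bound : ∀ {k} {p M} → ¬ (p I M) → (f : Fin k → Line) → (∀ i → p I f i) →
                   Injective _≡_ _≡_ f → k ≤ suc q
    pencil-bound p∉M f p∈f f-inj =
      points-on-line-bound _ (λ _ → meet-incʳ _ _ _) (meet-injective p∉M f p∈f f-inj)

module CompleteBipartiteEmbedding (π : ProjectivePlane) {n q : ℕ} (emb : Embedding (K n q) π) where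
  open ProjectivePlane π
  open PlaneProperties π
  open Embedding emb

  φU : Fin n → Point
  φU u = φ (inj₁ u)

  φU-≢ : ∀ {a b} → a ≢ b → φU a ≢ φU b
  φU-≢ a≢b eq = a≢b (inj₁-injective (φ-inj _ _ eq))

  UV-≢ : ∀ u v → φU u ≢ φ (inj₂ v)
  UV-≢ u v eq with φ-inj _ _ eq
  ... | ()

  edge : Fin n → Fin q → Line
  edge u v = edgeLine (K n q) π φ φ-inj (inj₁ u) (inj₂ v) (uv u v)

  edge-injective : ∀ {u u' v v'} → edge u v ≡ edge u' v' → u ≡ u' × v ≡ v'
  edge-injective eq with line-inj _ _ _ _ (uv _ _) (uv _ _) eq
  ... | inj₁ (u≡u' , v≡v') = inj₁-injective u≡u' , inj₂-injective v≡v'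
  ... | inj₂ (() , _)

  U-off-edge : ∀ {u' u} v → u' ≢ u → ¬ (φU u' I edge u v)
  U-off-edge {u'} v u'≢u u'∈uv = u'≢u (proj₁ (edge-injective
    (line-unique (UV-≢ u' v) (join-incˡ _ _ _) (join-incʳ _ _ _) u'∈uv (join-incʳ _ _ _))))

  module _ {a b : Fin n} (a≢b : a ≢ b) where

    line : Line
    line = join (φU a) (φU b) (φU-≢ a≢b)

    module _ {c : Fin n} (c∉line : ¬ (φU c I line)) where

      c≢a : c ≢ a
      c≢a refl = c∉line (join-incˡ _ _ _)

      line-ac : Line
      line-ac = join (φU a) (φU c) (φU-≢ (c≢a ∘ sym))

      pencil : Fin (suc (suc q)) → Line
      pencil = line ∷ line-ac ∷ edge a

      a∈pencil : ∀ i → φU a I pencil i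
      a∈pencil zero          = join-incˡ _ _ _
      a∈pencil (suc zero)    = join-incˡ _ _ _
      a∈pencil (suc (suc v)) = join-incˡ _ _ _

      pencil-injective : Injective _≡_ _≡_ pencil
      pencil-injective = ∷-injective line∉ (∷-injective line-ac∉ (proj₂ ∘ edge-injective))
        where
        line∉ : ∀ i → line ≢ (line-ac ∷ edge a) i
        line∉ zero    = I-respects-≢ (join-incʳ _ _ _) c∉line ∘ sym
        line∉ (suc v) = I-respects-≢ (join-incʳ _ _ _) (U-off-edge v (a≢b ∘ sym))

        line-ac∉ : ∀ v → line-ac ≢ edge a v
        line-ac∉ v = I-respects-≢ (join-incʳ _ _ _) (U-off-edge v c≢a)

    on-line : HasOrder π q → Fin q → ∀ c → φU c I line
    on-line order v₀ c = I-stable λ c∉line →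
      1+n≰n (pencil-bound order (U-off-edge v₀ a≢b)
               (pencil c∉line) (a∈pencil c∉line) (pencil-injective c∉line))

lemma3p4 : (π : ProjectivePlane) (q n : ℕ) → HasOrder π q → 2 ≤ n → n ≤ q →
    (φ : Embedding (K n q) π) →
    ProjectivePlane.Collinear π (λ u → Embedding.φ φ (inj₁ u))
lemma3p4 π (suc q) (suc (suc k)) order (s≤s (s≤s _)) _ emb =
  line 0≢1 , on-line 0≢1 order zero
  where
  open CompleteBipartiteEmbedding π emb
  0≢1 : _≢_ {A = Fin (suc (suc k))} zero (suc zero)
  0≢1 ()
lemma3p4 π 0 (suc (suc k)) order (s≤s (s≤s _)) ()
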